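{- Let $\preceq_+\in\{\le_{\mathrm{lex}},\le_{\mathrm{pos}}\}$. For any position $p\in[n]$, if $p\notin QI_{\mathrm{GLPF}}$ then $\mathrm{GLPF}_{\preceq_+}[p]=\mathrm{GLPF}_{\preceq_+}[p-1]-1$. Consequently, the arrays $PLCP$ and $LPF$ satisfy the same interpolation property with respect to $QI_{\mathrm{GLPF}}$ (for $\preceq_+=\le_{\mathrm{lex}}$ and $\preceq_+=\le_{\mathrm{pos}}$, respectively).
   Context: Let $T=T[1..n]$ be a text over an integer alphabet with total order, ending with a unique smallest end-marker $\$$. $T_p=T[p..n]$; for a suffix $S$, $\mathrm{pos}(S)=n+1-|S|$; $lcp(X,Y)$ is the longest-common-prefix length. $\le_{\mathrm{lex}}$ is lexicographic order; $X\le_{\mathrm{pos}}Y$ iff $|X|\ge|Y|$; $\prec$ denotes strict versions. $\mathrm{GLPF}_{\preceq_+}[p]=\max(\{lcp(T_p,T_q): T_q\prec_+T_p\}\cup\{0\})$. $SA$ is the suffix array; $PLCP[p]=0$ if $p=SA[1]$, else $lcp(T_p,T_{SA[SA^{ -1}[p]-1]})$; $LPF[p]=\max(\{lcp(T_p,T_q):q<p\}\cup\{0\})$. The CDAWG $G$ of $T$ is the edge-labeled DAG obtained from the suffix tree of $T$ by merging isomorphic subtrees; it has a root and a sink, edges $f=(v,X,w)$ with nonempty labels, outgoing edges of a node start with distinct symbols, and spelling root-to-sink paths is a bijection onto the suffixes of $T$; $E$ is its edge set. For a node $v$, $N_-(v)$/$N_+(v)$ are incoming/outgoing edges, $U_-(v)$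 the strings spelled by root-to-$v$ paths, $U_+(v)$ those spelled by $v$-to-sink paths. Let $\preceq_-=\le_{\mathrm{pos}}$ and $\mathrm{repr}_\delta(v)=\min_{\preceq_\delta}U_\delta(v)$ (strings identified with their unique paths). An edge of $N_-(v)$ is $(-)$-primary if it is the last edge of the path of $\mathrm{repr}_-(v)$; an edge of $N_+(v)$ is $(+)$-primary if it is the first edge of the path of $\mathrm{repr}_+(v)$; $EP_\delta$ = $\delta$-primary edges, $ES_\delta=E\setminus EP_\delta$. A suffix $S$ with root-to-sink path $(f_1,\dots,f_\ell)$ is $(+)$-canonical if either all $f_i\in EP_+$, or for some $k$: $f_1,\dots,f_{k-1}\in EP_-$, $f_k\in ES_+$, $f_{k+1},\dots,f_\ell\in EP_+$. $CS_+$ is the set of $(+)$-canonical suffixes and $QI_{\mathrm{GLPF}}=\{\mathrm{pos}(S):S\in CS_+\}$. -}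

module Defs where

open import Data.Nat using (ℕ; zero; suc; _∸_; _<_; _≤_; _>_; _≥_; _⊔_)
open import Data.Nat.Properties using (<-cmp; _≟_; _<?_; ≤-refl)
import Data.Nat.Properties as ℕₚ
open import Data.List using (List; []; _∷_; _++_; drop; length; map; upTo; foldr)
open import Data.List.Membership.Propositional using (_∈_; _∉_)
open import Data.List.Relation.Unary.All using (All)
open import Data.List.Relation.Binary.Lex.Strict using (Lex-<; Lex-≤; <-decidable)
open import Data.Product using (Σ; ∃; ∃₂; _×_; _,_)
open import Data.Sum using (_⊎_)
open import Data.Bool using (if_then_else_)
open import Relation.Nullary using (¬_; Dec; does; yes; no)
open import Relation.Binary.PropositionalEquality using (_≡_; _≢_)
open import Function.Bundles using (_⇔_)

Str : Set
Str = List ℕ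

WellFormedText : Str → Set
WellFormedText T =
  Σ Str λ T' → Σ ℕ λ d → (T ≡ T' ++ (d ∷ [])) × (d ∉ T') × (∀ c → c ∈ T' → d < c)

-- T_p = T[p..n], positions are 1-based (p ∈ [1..n])
suf : Str → ℕ → Str
suf T p = drop (p ∸ 1) T

InRange : Str → ℕ → Set
InRange T p = 1 ≤ p × p ≤ length T

lcp : Str → Str → ℕ
lcp (a ∷ x) (b ∷ y) with a ≟ b
... | yes _ = suc (lcp x y)
... | no  _ = 0
lcp _ _ = 0

maxList : List ℕ → ℕ
maxList = foldr _⊔_ 0

range1 : ℕ → List ℕ
range1 m = map suc (upTo m)

_<lex_ : Str → Str → Set
_<lex_ = Lex-< _≡_ _<_

_≤lex_ : Str → Str → Set
_≤lex_ = Lex-≤ _≡_ _<_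

_≤pos_ : Str → Str → Set
X ≤pos Y = length X ≥ length Y

_<pos_ : Str → Str → Set
X <pos Y = length X > length Y

data Ord₊ : Set where
  lexo posn : Ord₊

_⊢_⪯_ : Ord₊ → Str → Str → Set
lexo ⊢ X ⪯ Y = X ≤lex Y
posn ⊢ X ⪯ Y = X ≤pos Y

_⊢_≺_ : Ord₊ → Str → Str → Set
lexo ⊢ X ≺ Y = X <lex Y
posn ⊢ X ≺ Y = X <pos Y

≺-dec : (o : Ord₊) → (X Y : Str) → Dec (o ⊢ X ≺ Y)
≺-dec lexo X Y = <-decidable _≟_ _<?_ X Y
≺-dec posn X Y = length Y <? length X

GLPF : Ord₊ → Str → ℕ → ℕ
GLPF o T p = maxList (map (λ q → if does (≺-dec o (suf T q) (suf T p))
                                  then lcp (suf T p) (suf T q) else 0)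
                          (range1 (length T)))

LPF : Str → ℕ → ℕ
LPF T p = maxList (map (λ q → lcp (suf T p) (suf T q)) (range1 (p ∸ 1)))

-- With SA the suffix array, SA[SA⁻¹[p]-1] is the position q
-- whose suffix is the lexicographic predecessor of T_p among all suffixes
-- (p = SA[1] iff T_p has no lexicographic predecessor).
LexPred : Str → ℕ → ℕ → Set
LexPred T q p = InRange T q × (suf T q <lex suf T p) ×
  (∀ r → InRange T r → ¬ ((suf T q <lex suf T r) × (suf T r <lex suf T p)))

IsPLCP : Str → ℕ → ℕ → Set
IsPLCP T p ℓ =
    ((∀ q → InRange T q → ¬ (suf T q <lex suf T p)) × ℓ ≡ 0)
  ⊎ (Σ ℕ λ q → LexPred T q p × ℓ ≡ lcp (suf T p) (suf T q))

IsSuf : Str → Str → Set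
IsSuf T y = (y ≢ []) × ∃ λ u → u ++ y ≡ T

Sub : Str → Str → Set
Sub T x = ∃₂ λ u w → u ++ x ++ w ≡ T

Cont : Str → Str → Str → Set
Cont T x z = IsSuf T (x ++ z)

-- (explicit) nodes of the suffix tree of T, identified with the strings
-- they spell: the root, the leaves (suffixes of T) and the right-branching
-- substrings.
STNode : Str → Str → Set
STNode T x = (x ≡ [])
           ⊎ IsSuf T x
           ⊎ (∃₂ λ a b → (a ≢ b) × Sub T (x ++ (a ∷ [])) × Sub T (x ++ (b ∷ [])))

STEdge : Str → Str → Str → Set
STEdge T x X = STNode T x × STNode T (x ++ X) × (X ≢ []) ×
  (∀ Y Y' → Y ++ Y' ≡ X → Y ≢ [] → Y' ≢ [] → ¬ STNode T (x ++ Y))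

-- Two suffix-tree nodes have isomorphic subtrees iff they spell the same
-- sets of continuations towards the leaves.  The CDAWG node of x is the
-- class of x under this relation.
_⊢_∼_ : Str → Str → Str → Set
T ⊢ x ∼ y = ∀ z → Cont T x z ⇔ Cont T y z

-- A CDAWG edge is represented by a suffix-tree edge (x , X) (x the source
-- string, X the label); two such represent the same CDAWG edge iff their
-- sources are merged and their labels coincide.
Edge : Set
Edge = Str × Str

SameEdge : Str → Edge → Edge → Set
SameEdge T (x , X) (y , Y) = (T ⊢ x ∼ y) × (X ≡ Y)

-- U₋(v) for v the node of w: the strings spelled by root-to-v paths,
-- i.e. the suffix-tree nodes merged with w.  U₊(v) = Cont T w.
-- repr₋(v) = min_{≤pos} U₋(v)
IsRepr₋ : Str → Str → Str → Set
IsRepr₋ T w r = STNode T r × (T ⊢ r ∼ w) ×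
  (∀ y → STNode T y → T ⊢ y ∼ w → r ≤pos y)

IsRepr₊ : Ord₊ → Str → Str → Str → Set
IsRepr₊ o T w z = Cont T w z × (∀ z' → Cont T w z' → o ⊢ z ⪯ z')

-- (−)-primary: f ∈ N₋(v) is the last edge of the path of repr₋(v)
Primary₋ : Str → Edge → Set
Primary₋ T (x , X) = Σ Str λ r → IsRepr₋ T (x ++ X) r ×
  (Σ Str λ y → Σ Str λ Y → (y ++ Y ≡ r) × STEdge T y Y × SameEdge T (x , X) (y , Y))

-- (+)-primary: f ∈ N₊(v) is the first edge of the path of repr₊(v)
Primary₊ : Ord₊ → Str → Edge → Set
Primary₊ o T (x , X) = Σ Str λ z → IsRepr₊ o T x z ×
  (Σ Str λ Y → Σ Str λ z' → (Y ++ z' ≡ z) × STEdge T x Y × SameEdge T (x , X) (x , Y))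

data PathFrom (T : Str) : Str → Str → List Edge → Set where
  done : ∀ {x} → PathFrom T x [] []
  step : ∀ {x X z es} → STEdge T x X → PathFrom T (x ++ X) z es →
         PathFrom T x (X ++ z) ((x , X) ∷ es)

Canonical₊ : Ord₊ → Str → Str → Set
Canonical₊ o T S = Σ (List Edge) λ es → PathFrom T [] S es ×
  ( All (Primary₊ o T) es
  ⊎ (Σ (List Edge) λ as → Σ Edge λ f → Σ (List Edge) λ bs →
       (es ≡ as ++ f ∷ bs) × All (Primary₋ T) as × ¬ Primary₊ o T f
       × All (Primary₊ o T) bs))

QI : Ord₊ → Str → ℕ → Set
QI o T p = InRange T p × Canonical₊ o T (suf T p)

{-# OPTIONS --safe #-}
module Submission where

-- Stripping the first character of a GLPF witness for p - 1 gives one for p, so always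
-- GLPF[p-1] ≤ GLPF[p] + 1, and it suffices to show GLPF[p-1] > ℓ := GLPF[p] off QI.
-- If the path of T_p is not (+)-canonical, it has an edge f that is not (+)-primary but is
-- followed only by (+)-primary edges, and an earlier edge g that is not (-)-primary.
-- An edge whose source is deeper than ℓ spells the ⪯₊-least continuation of its source, so
-- f starts at depth ≤ ℓ, and hence the node w entered by g is a common prefix of T_p and of
-- its GLPF witness T_q. As g is not (-)-primary, w is not the longest string of its CDAWG
-- node, so T_p and T_q are preceded by the same character, which yields GLPF[p-1] ≥ ℓ + 1.
-- Suffix-tree nodes are not decidable here, so the path and these case distinctions are
-- obtained under double negation, which the decidable conclusion absorbs.

open import Defs
open import Data.Nat using (ℕ; zero; suc; _+_; _∸_; _<_; _≤_; _⊓_; z≤n; s≤s; s≤s⁻¹)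
open import Data.Nat.Properties
open import Data.List using ([]; _∷_; _++_; _∷ʳ_; drop; take; length; map)
open import Data.List.Properties using (++-assoc; ++-identityʳ; ++-cancelʳ; ∷-injectiveˡ; ∷-injectiveʳ; length-++; length-++-≤ˡ; length-++-≤ʳ; length-take; length-drop; take++drop≡id; drop-all; foldr-forcesᵇ)
open import Data.List.Membership.Propositional using (_∈_)
open import Data.List.Membership.Propositional.Properties using (∈-map⁺; ∈-map⁻; ∈-upTo⁺; ∈-upTo⁻; foldr-selective)
open import Data.List.Relation.Unary.All as All using (All; []; _∷_)
open import Data.List.Relation.Binary.Lex.Strict as Lex using (base; halt; this; next)
open import Data.List.Relation.Binary.Pointwise using (Pointwise-≡⇒≡)
open import Data.Product using (∃; ∃₂; _×_; _,_; proj₁; proj₂)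
open import Data.Sum using (_⊎_; inj₁; inj₂)
open import Data.Bool using (if_then_else_)
open import Function using (id)
open import Function.Bundles using (Equivalence; mk⇔)
open import Relation.Binary.Definitions using (tri<; tri≈; tri>)
open import Relation.Binary.PropositionalEquality using (_≡_; _≢_; refl; sym; trans; cong; cong₂; subst; subst₂; module ≡-Reasoning)
open import Relation.Nullary using (¬_; yes; no; contradiction)
open import Relation.Nullary.Decidable using (dec-true; decidable-stable; _×-dec_; ¬¬-excluded-middle)
open import Relation.Nullary.Negation using (¬¬-map)

-- Lists and longest common prefixes

maxList-map-upper : ∀ {A : Set} (f : A → ℕ) {x xs} → x ∈ xs → f x ≤ maxList (map f xs)
maxList-map-upper f {xs = xs} x∈xs = All.lookup
  (foldr-forcesᵇ {P = _≤ maxList (map f xs)}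
     (λ m n m⊔n≤o → m⊔n≤o⇒m≤o m n m⊔n≤o , m⊔n≤o⇒n≤o m n m⊔n≤o) 0 (map f xs) ≤-refl)
  (∈-map⁺ f x∈xs)

maxList-map-attained : ∀ {A : Set} (f : A → ℕ) xs →
  maxList (map f xs) ≡ 0 ⊎ ∃ λ x → x ∈ xs × maxList (map f xs) ≡ f x
maxList-map-attained f xs with foldr-selective ⊔-sel 0 (map f xs)
... | inj₁ ≡0 = inj₁ ≡0
... | inj₂ ∈fxs = inj₂ (∈-map⁻ f ∈fxs)

∈-range1 : ∀ {n q} → 1 ≤ q → q ≤ n → q ∈ range1 n
∈-range1 {q = suc i} _ q≤n = ∈-map⁺ suc (∈-upTo⁺ q≤n)

∈-range1⁻ : ∀ {n q} → q ∈ range1 n → 1 ≤ q × q ≤ n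
∈-range1⁻ q∈ with ∈-map⁻ suc q∈
... | _ , i∈ , refl = s≤s z≤n , ∈-upTo⁻ i∈

nonempty⇒0<length : ∀ {X : Str} → X ≢ [] → 0 < length X
nonempty⇒0<length {[]} X≢[] = contradiction refl X≢[]
nonempty⇒0<length {_ ∷ _} _ = s≤s z≤n

drop-length-++ : ∀ (u v : Str) → drop (length u) (u ++ v) ≡ v
drop-length-++ [] v = refl
drop-length-++ (_ ∷ u) v = drop-length-++ u v

drop-suc : ∀ k (xs : Str) → drop 1 (drop k xs) ≡ drop (suc k) xs
drop-suc zero xs = refl
drop-suc (suc k) [] = refl
drop-suc (suc k) (_ ∷ xs) = drop-suc k xs

∷-++-last : ∀ b (bs x : Str) → ∃₂ λ y c → b ∷ bs ++ x ≡ y ++ c ∷ x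
∷-++-last b [] x = [] , b , refl
∷-++-last b (b′ ∷ bs) x with ∷-++-last b′ bs x
... | y , c , eq = b ∷ y , c , cong (b ∷_) eq

++-longer-suffix : ∀ (a b : Str) {x y} → a ++ y ≡ b ++ x → length x < length y →
                   ∃₂ λ y′ c → y ≡ y′ ++ c ∷ x
++-longer-suffix [] [] refl x<y = contradiction x<y (<-irrefl refl)
++-longer-suffix [] (b ∷ bs) {x} refl _ = ∷-++-last b bs x
++-longer-suffix (a ∷ as) [] {y = y} refl x<y = contradiction (length-++-≤ʳ y {a ∷ as}) (<⇒≱ x<y)
++-longer-suffix (_ ∷ as) (_ ∷ bs) eq x<y = ++-longer-suffix as bs (∷-injectiveʳ eq) x<y

∷ʳ-nonempty : ∀ (acc : Str) c → acc ∷ʳ c ≢ []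
∷ʳ-nonempty [] _ ()
∷ʳ-nonempty (_ ∷ _) _ ()

∷ʳ-prefix : ∀ (Y Y′ acc : Str) c → Y ++ Y′ ≡ acc ∷ʳ c → Y′ ≢ [] → ∃ λ Y″ → Y ++ Y″ ≡ acc
∷ʳ-prefix [] _ acc _ _ _ = acc , refl
∷ʳ-prefix (_ ∷ []) [] [] _ _ Y′≢[] = contradiction refl Y′≢[]
∷ʳ-prefix (_ ∷ []) (_ ∷ _) [] _ ()
∷ʳ-prefix (_ ∷ _ ∷ _) _ [] _ ()
∷ʳ-prefix (y ∷ Y) Y′ (a ∷ acc) c eq Y′≢[] with refl ← ∷-injectiveˡ eq
  with Y″ , eq′ ← ∷ʳ-prefix Y Y′ acc c (∷-injectiveʳ eq) Y′≢[] = Y″ , cong (y ∷_) eq′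

lcp-∷ : ∀ c (X Y : Str) → lcp (c ∷ X) (c ∷ Y) ≡ suc (lcp X Y)
lcp-∷ c X Y with c ≟ c
... | yes _ = refl
... | no c≢c = contradiction refl c≢c

lcp-∷-≢ : ∀ {c d} (X Y : Str) → c ≢ d → lcp (c ∷ X) (d ∷ Y) ≡ 0
lcp-∷-≢ {c} {d} X Y c≢d with c ≟ d
... | yes c≡d = contradiction c≡d c≢d
... | no _ = refl

lcp-[]ʳ : ∀ (X : Str) → lcp X [] ≡ 0
lcp-[]ʳ [] = refl
lcp-[]ʳ (_ ∷ _) = refl

length≤lcp-++ : ∀ (w X Y : Str) → length w ≤ lcp (w ++ X) (w ++ Y)
length≤lcp-++ [] X Y = z≤n
length≤lcp-++ (c ∷ w) X Y rewrite lcp-∷ c (w ++ X) (w ++ Y) = s≤s (length≤lcp-++ w X Y)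

lcp-prefix : ∀ (w X Y : Str) → length w ≤ lcp (w ++ X) Y → ∃ λ Y′ → Y ≡ w ++ Y′
lcp-prefix [] X Y _ = Y , refl
lcp-prefix (c ∷ w) X [] ()
lcp-prefix (c ∷ w) X (d ∷ Y) w≤lcp with c ≟ d | w≤lcp
... | yes refl | s≤s w≤lcp′ = let Y′ , Y≡ = lcp-prefix w X Y w≤lcp′ in Y′ , cong (c ∷_) Y≡
... | no _ | ()

lcp-mono-<lex : ∀ {X Y Z : Str} → X <lex Y → Y <lex Z → lcp Z X ≤ lcp Z Y
lcp-mono-<lex {[]} {_} {[]} _ _ = z≤n
lcp-mono-<lex {[]} {_} {_ ∷ _} _ _ = z≤n
lcp-mono-<lex {x ∷ X} {y ∷ Y} {z ∷ Z} (this x<y) (this y<z)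
  rewrite lcp-∷-≢ Z X (>⇒≢ (<-trans x<y y<z)) = z≤n
lcp-mono-<lex {x ∷ X} {y ∷ Y} {.y ∷ Z} (this x<y) (next refl _)
  rewrite lcp-∷-≢ Z X (>⇒≢ x<y) = z≤n
lcp-mono-<lex {x ∷ X} {.x ∷ Y} {z ∷ Z} (next refl _) (this x<z)
  rewrite lcp-∷-≢ Z X (>⇒≢ x<z) = z≤n
lcp-mono-<lex {x ∷ X} {.x ∷ Y} {.x ∷ Z} (next refl X<Y) (next refl Y<Z)
  rewrite lcp-∷ x Z X | lcp-∷ x Z Y = s≤s (lcp-mono-<lex X<Y Y<Z)

<lex⇒≤lex : ∀ {X Y} → X <lex Y → X ≤lex Y
<lex⇒≤lex (base ())
<lex⇒≤lex halt = halt
<lex⇒≤lex (this x<y) = this x<y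
<lex⇒≤lex (next x≡y X<Y) = next x≡y (<lex⇒≤lex X<Y)

⪯-or-≻ : ∀ o X Y → o ⊢ X ⪯ Y ⊎ o ⊢ Y ≺ X
⪯-or-≻ lexo X Y with Lex.<-compare sym <-cmp X Y
... | tri< X<Y _ _ = inj₁ (<lex⇒≤lex X<Y)
... | tri≈ _ X≋Y _ = inj₁ (Lex.≤-reflexive _≡_ _<_ X≋Y)
... | tri> _ _ Y<X = inj₂ Y<X
⪯-or-≻ posn X Y with length Y ≤? length X
... | yes Y≤X = inj₁ Y≤X
... | no Y≰X = inj₂ (≰⇒> Y≰X)

≺-∷⁺ : ∀ o c {X Y} → o ⊢ Y ≺ X → o ⊢ (c ∷ Y) ≺ (c ∷ X)
≺-∷⁺ lexo c Y<X = next refl Y<X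
≺-∷⁺ posn c Y≺X = s≤s Y≺X

≺-++⁺ˡ : ∀ o (w : Str) {X Y} → o ⊢ Y ≺ X → o ⊢ (w ++ Y) ≺ (w ++ X)
≺-++⁺ˡ o [] Y≺X = Y≺X
≺-++⁺ˡ o (c ∷ w) Y≺X = ≺-∷⁺ o c (≺-++⁺ˡ o w Y≺X)

≺-∷⁻ : ∀ o {c X Y} → o ⊢ (c ∷ Y) ≺ (c ∷ X) → o ⊢ Y ≺ X
≺-∷⁻ lexo (this c<c) = contradiction c<c (<-irrefl refl)
≺-∷⁻ lexo (next _ Y<X) = Y<X
≺-∷⁻ posn Y≺X = s≤s⁻¹ Y≺X

lcp≤suc-lcp-tail : ∀ o {X Y : Str} b → o ⊢ Y ≺ X →
  (o ⊢ drop 1 Y ≺ drop 1 X → drop 1 Y ≢ [] → lcp (drop 1 X) (drop 1 Y) ≤ b) →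
  lcp X Y ≤ suc b
lcp≤suc-lcp-tail o {[]} _ _ _ = z≤n
lcp≤suc-lcp-tail o {_ ∷ _} {[]} _ _ _ = z≤n
lcp≤suc-lcp-tail o {c ∷ X} {d ∷ Y} b Y≺X tail-bound with c ≟ d
... | no _ = z≤n
... | yes refl with Y
...   | [] = s≤s (≤-trans (≤-reflexive (lcp-[]ʳ X)) z≤n)
...   | Y@(_ ∷ _) = s≤s (tail-bound (≺-∷⁻ o Y≺X) λ ())

-- Suffixes and their positions

suf-nonempty : ∀ {T p} → InRange T p → suf T p ≢ []
suf-nonempty {T} {suc j} (_ , j<n) eq =
  <⇒≢ (m<n⇒0<n∸m j<n) (sym (trans (sym (length-drop j T)) (cong length eq)))

nonempty⇒InRange : ∀ T j → suf T (suc j) ≢ [] → InRange T (suc j)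
nonempty⇒InRange T j ne = s≤s z≤n , ≰⇒> (λ n≤j → ne (drop-all j T n≤j))

InRange-pred : ∀ T {p} → 1 < p → InRange T p → InRange T (p ∸ 1)
InRange-pred _ {suc zero} (s≤s ()) _
InRange-pred _ {suc (suc _)} _ (_ , p≤n) = s≤s z≤n , <⇒≤ p≤n

suf-IsSuf : ∀ {T p} → InRange T p → IsSuf T (suf T p)
suf-IsSuf {T} {p} p∈ = suf-nonempty p∈ , take (p ∸ 1) T , take++drop≡id (p ∸ 1) T

IsSuf⇒position : ∀ {T y} → IsSuf T y → ∃ λ q → InRange T q × suf T q ≡ y
IsSuf⇒position {T} {y} (y≢[] , u , u++y≡T) =
  suc (length u) , (s≤s z≤n , |u|<n) , trans (cong (drop (length u)) (sym u++y≡T)) (drop-length-++ u y)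
  where
  |u|<n : length u < length T
  |u|<n = subst (length u <_) (trans (sym (length-++ u)) (cong length u++y≡T))
                (m<m+n (length u) (nonempty⇒0<length y≢[]))

suf-prefix-length : ∀ {T p u} → InRange T p → u ++ suf T p ≡ T → length u ≡ p ∸ 1
suf-prefix-length {T} {p} {u} (_ , p≤n) u++S≡T = begin
  length u                 ≡⟨ cong length (++-cancelʳ (suf T p) u (take (p ∸ 1) T)
                                (trans u++S≡T (sym (take++drop≡id (p ∸ 1) T)))) ⟩
  length (take (p ∸ 1) T)  ≡⟨ length-take (p ∸ 1) T ⟩
  (p ∸ 1) ⊓ length T       ≡⟨ m≤n⇒m⊓n≡m (≤-trans (m∸n≤m p 1) p≤n) ⟩
  p ∸ 1                    ∎
  where open ≡-Reasoning

m+1≡p∸1⇒p≡2+m : ∀ {m p} → m + 1 ≡ p ∸ 1 → p ≡ suc (suc m)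
m+1≡p∸1⇒p≡2+m {m} {zero} eq = contradiction (trans (+-comm 1 m) eq) λ ()
m+1≡p∸1⇒p≡2+m {m} {suc zero} eq = contradiction (trans (+-comm 1 m) eq) λ ()
m+1≡p∸1⇒p≡2+m {m} {suc (suc _)} eq = cong suc (sym (trans (+-comm 1 m) eq))

IsSuf-∷⇒preceded : ∀ {T c} p → InRange T p → IsSuf T (c ∷ suf T p) →
                   1 < p × suf T (p ∸ 1) ≡ c ∷ suf T p
IsSuf-∷⇒preceded {T} {c} p p∈ (_ , u , u++cS≡T)
  with refl ← m+1≡p∸1⇒p≡2+m {p = p} (trans (sym (length-++ u))
                (suf-prefix-length p∈ (trans (++-assoc u (c ∷ []) (suf T p)) u++cS≡T))) =
  s≤s (s≤s z≤n) , trans (cong (drop (length u)) (sym u++cS≡T)) (drop-length-++ u _)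

IsSuf-++⁻ʳ : ∀ {T} u {v} → v ≢ [] → IsSuf T (u ++ v) → IsSuf T v
IsSuf-++⁻ʳ u {v} v≢[] (_ , t , t++u++v≡T) = v≢[] , t ++ u , trans (++-assoc t u v) t++u++v≡T

IsSuf-longer : ∀ {T y w s} → IsSuf T (y ++ s) → IsSuf T (w ++ s) → length w < length y →
               ∃₂ λ y′ c → y ≡ y′ ++ c ∷ w
IsSuf-longer {y = y} {w} {s} (_ , u , u++ys≡T) (_ , u′ , u′++ws≡T) =
  ++-longer-suffix u u′ (++-cancelʳ s (u ++ y) (u′ ++ w)
    (trans (++-assoc u y s) (trans u++ys≡T (trans (sym u′++ws≡T) (sym (++-assoc u′ w s))))))

-- The GLPF array

GLPF-upper : ∀ o T p {q} → InRange T q → o ⊢ suf T q ≺ suf T p → lcp (suf T p) (suf T q) ≤ GLPF o T p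
GLPF-upper o T p {q} (1≤q , q≤n) q≺p =
  subst (_≤ GLPF o T p) (cong (λ b → if b then lcp (suf T p) (suf T q) else 0) (dec-true (≺-dec o _ _) q≺p))
        (maxList-map-upper _ (∈-range1 1≤q q≤n))

GLPF-attained : ∀ o T p → GLPF o T p ≡ 0 ⊎
  ∃ λ q → InRange T q × o ⊢ suf T q ≺ suf T p × GLPF o T p ≡ lcp (suf T p) (suf T q)
GLPF-attained o T p with maxList-map-attained _ (range1 (length T))
... | inj₁ ≡0 = inj₁ ≡0
... | inj₂ (q , q∈ , ≡entry) with ≺-dec o (suf T q) (suf T p)
...   | yes q≺p = inj₂ (q , ∈-range1⁻ q∈ , q≺p , ≡entry)
...   | no _ = inj₁ ≡entry

GLPF-pred≤suc : ∀ o T {p} → 1 < p → p ≤ length T → GLPF o T (p ∸ 1) ≤ suc (GLPF o T p)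
GLPF-pred≤suc o T {suc zero} (s≤s ()) _
GLPF-pred≤suc o T {suc (suc k)} _ p≤n with GLPF-attained o T (suc k)
... | inj₁ ≡0 = ≤-trans (≤-reflexive ≡0) z≤n
... | inj₂ (zero , (() , _) , _)
... | inj₂ (suc j , _ , j≺k , ≡lcp) = begin
  GLPF o T (suc k)             ≡⟨ ≡lcp ⟩
  lcp (drop k T) (drop j T)    ≤⟨ lcp≤suc-lcp-tail o _ j≺k tail-bound ⟩
  suc (GLPF o T (suc (suc k))) ∎
  where
  open ≤-Reasoning
  tail-bound : o ⊢ drop 1 (drop j T) ≺ drop 1 (drop k T) → drop 1 (drop j T) ≢ [] →
               lcp (drop 1 (drop k T)) (drop 1 (drop j T)) ≤ GLPF o T (suc (suc k))
  tail-bound ≺ ≢[] rewrite drop-suc k T | drop-suc j T =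
    GLPF-upper o T (suc (suc k)) (nonempty⇒InRange T (suc j) ≢[]) ≺

-- Paths and primary edges

∼-refl : ∀ {T x} → T ⊢ x ∼ x
∼-refl _ = mk⇔ id id

NodeFree : Str → Str → Str → Set
NodeFree T x acc = ∀ Y Y′ → Y ++ Y′ ≡ acc → Y ≢ [] → ¬ STNode T (x ++ Y)

NodeFree-[] : ∀ {T x} → NodeFree T x []
NodeFree-[] [] _ _ Y≢[] = contradiction refl Y≢[]

NodeFree-∷ʳ : ∀ {T x acc c} → NodeFree T x acc → ¬ STNode T (x ++ acc ∷ʳ c) → NodeFree T x (acc ∷ʳ c)
NodeFree-∷ʳ {T} {x} {acc} {c} free ¬node Y [] Y++[]≡ _ =
  subst (λ Z → ¬ STNode T (x ++ Z)) (sym (trans (sym (++-identityʳ Y)) Y++[]≡)) ¬node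
NodeFree-∷ʳ {acc = acc} {c} free ¬node Y Y′@(_ ∷ _) Y++Y′≡ Y≢[] =
  let Y″ , Y++Y″≡ = ∷ʳ-prefix Y Y′ acc c Y++Y′≡ (λ ()) in free Y Y″ Y++Y″≡ Y≢[]

NodeFree⇒STEdge : ∀ {T x acc c} → STNode T x → STNode T (x ++ acc ∷ʳ c) → NodeFree T x acc →
                  STEdge T x (acc ∷ʳ c)
NodeFree⇒STEdge {acc = acc} {c} x-node next-node free =
  x-node , next-node , ∷ʳ-nonempty acc c ,
  λ Y Y′ Y++Y′≡ Y≢[] Y′≢[] → let Y″ , Y++Y″≡ = ∷ʳ-prefix Y Y′ acc c Y++Y′≡ Y′≢[] in free Y Y″ Y++Y″≡ Y≢[]

¬¬path-via : ∀ {T} x acc z → STNode T x → STNode T (x ++ acc ++ z) → NodeFree T x acc →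
             ¬ ¬ (∃ λ es → PathFrom T x (acc ++ z) es)
¬¬path-via x [] [] _ _ _ k = k ([] , done)
¬¬path-via {T} x acc@(_ ∷ _) [] _ end-node free _ =
  free acc [] (++-identityʳ acc) (λ ()) (subst (λ Z → STNode T (x ++ Z)) (++-identityʳ acc) end-node)
¬¬path-via {T} x acc (c ∷ z) x-node end-node free k =
  ¬¬-excluded-middle {A = STNode T (x ++ acc ∷ʳ c)} λ where
    (yes next-node) →
      ¬¬path-via (x ++ acc ∷ʳ c) [] z next-node
        (subst (STNode T) (sym (trans (++-assoc x (acc ∷ʳ c) z) acc∷ʳc++z≡)) end-node)
        NodeFree-[] λ (es , path) →
        k (_ , subst (λ Z → PathFrom T x Z _) (++-assoc acc (c ∷ []) z)
                     (step (NodeFree⇒STEdge x-node next-node free) path))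
    (no ¬next-node) →
      ¬¬path-via x (acc ∷ʳ c) z x-node (subst (STNode T) (sym acc∷ʳc++z≡) end-node)
        (NodeFree-∷ʳ free ¬next-node) λ (es , path) →
        k (es , subst (λ Z → PathFrom T x Z es) (++-assoc acc (c ∷ []) z) path)
  where
  acc∷ʳc++z≡ : x ++ (acc ∷ʳ c) ++ z ≡ x ++ acc ++ c ∷ z
  acc∷ʳc++z≡ = cong (x ++_) (++-assoc acc (c ∷ []) z)

¬¬path : ∀ {T x z} → STNode T x → STNode T (x ++ z) → ¬ ¬ (∃ λ es → PathFrom T x z es)
¬¬path {x = x} {z} x-node z-node = ¬¬path-via x [] z x-node z-node NodeFree-[]

path-++ : ∀ {T x z} as {bs} → PathFrom T x z (as ++ bs) →
          ∃₂ λ m z′ → z ≡ m ++ z′ × PathFrom T (x ++ m) z′ bs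
path-++ {T} {x} {z} [] {bs} path =
  [] , z , refl , subst (λ y → PathFrom T y z bs) (sym (++-identityʳ x)) path
path-++ {T} (_ ∷ as) {bs} (step {x = x} {X} edge path) with path-++ as path
... | m , z′ , refl , path′ =
  X ++ m , z′ , sym (++-assoc X m z′) , subst (λ y → PathFrom T y z′ bs) (++-assoc x X m) path′

¬All⇒¬¬last-counterexample : ∀ {A : Set} {P : A → Set} xs → ¬ All P xs →
  ¬ ¬ (∃ λ ys → ∃ λ x → ∃ λ zs → xs ≡ ys ++ x ∷ zs × ¬ P x × All P zs)
¬All⇒¬¬last-counterexample [] ¬all _ = ¬all []
¬All⇒¬¬last-counterexample {P = P} (x ∷ xs) ¬all k = ¬¬-excluded-middle {A = All P xs} λ where
  (yes all) → k ([] , x , xs , refl , (λ px → ¬all (px ∷ all)) , all)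
  (no ¬all′) → ¬All⇒¬¬last-counterexample xs ¬all′ λ (ys , y , zs , eq , ¬py , all) →
    k (x ∷ ys , y , zs , cong (x ∷_) eq , ¬py , all)

deep-edge⇒primary₊ : ∀ o T {p x X r} → InRange T p → STEdge T x X → suf T p ≡ x ++ X ++ r →
                     GLPF o T p < length x → Primary₊ o T (x , X)
deep-edge⇒primary₊ o T {p} {x} {X} {r} p∈ edge S≡ deep =
  X ++ r , (x-cont , minimal) , X , r , refl , edge , ∼-refl , refl
  where
  x-cont : Cont T x (X ++ r)
  x-cont = subst (IsSuf T) S≡ (suf-IsSuf p∈)
  minimal : ∀ z → Cont T x z → o ⊢ (X ++ r) ⪯ z
  minimal z xz with ⪯-or-≻ o (X ++ r) z
  ... | inj₁ ⪯z = ⪯z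
  ... | inj₂ z≺ with IsSuf⇒position xz
  ...   | q , q∈ , q≡ = contradiction x≤GLPF (<⇒≱ deep)
    where
    open ≤-Reasoning
    x≤GLPF : length x ≤ GLPF o T p
    x≤GLPF = begin
      length x                   ≤⟨ length≤lcp-++ x (X ++ r) z ⟩
      lcp (x ++ X ++ r) (x ++ z) ≡⟨ cong₂ lcp (sym S≡) (sym q≡) ⟩
      lcp (suf T p) (suf T q)    ≤⟨ GLPF-upper o T p q∈
                                      (subst₂ (λ Y Z → o ⊢ Y ≺ Z) (sym q≡) (sym S≡) (≺-++⁺ˡ o x z≺)) ⟩
      GLPF o T p                 ∎

CommonLeftExtension : Str → Str → Str → Set
CommonLeftExtension T X Y = ∃ λ c → IsSuf T (c ∷ X) × IsSuf T (c ∷ Y)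

longest-in-class : ∀ {T w s s′} → Cont T w s → Cont T w s′ → ¬ CommonLeftExtension T (w ++ s) (w ++ s′) →
                   ∀ y → T ⊢ y ∼ w → length y ≤ length w
longest-in-class {T} {w} {s} {s′} ws ws′ ¬ext y y∼w with length y ≤? length w
... | yes y≤w = y≤w
... | no y≰w with IsSuf-longer (Equivalence.from (y∼w s) ws) ws (≰⇒> y≰w)
...   | y₁ , c , y≡ =
  contradiction (c , drop-y₁ (Equivalence.from (y∼w s) ws) , drop-y₁ (Equivalence.from (y∼w s′) ws′)) ¬ext
  where
  drop-y₁ : ∀ {t} → IsSuf T (y ++ t) → IsSuf T (c ∷ w ++ t)
  drop-y₁ {t} yt = IsSuf-++⁻ʳ y₁ (λ ())
    (subst (IsSuf T) (trans (cong (_++ t) y≡) (++-assoc y₁ (c ∷ w) t)) yt)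

STEdge-target-nonempty : ∀ {T x X} → STEdge T x X → 0 < length (x ++ X)
STEdge-target-nonempty {x = x} {X} (_ , _ , X≢[] , _) = <-≤-trans (nonempty⇒0<length X≢[]) (length-++-≤ʳ X {x})

longest⇒primary₋ : ∀ {T x X} → STEdge T x X →
                   (∀ y → STNode T y → T ⊢ y ∼ (x ++ X) → length y ≤ length (x ++ X)) → Primary₋ T (x , X)
longest⇒primary₋ {x = x} {X} edge longest =
  x ++ X , (proj₁ (proj₂ edge) , ∼-refl , longest) , x , X , refl , edge , ∼-refl , refl

GLPFDrop : Ord₊ → Str → ℕ → Set
GLPFDrop o T p = 1 < p × GLPF o T p < GLPF o T (p ∸ 1)

CommonLeftExtension⇒lcp<GLPF-pred : ∀ o T {p q} → InRange T p → InRange T q → o ⊢ suf T q ≺ suf T p →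
  CommonLeftExtension T (suf T p) (suf T q) → 1 < p × lcp (suf T p) (suf T q) < GLPF o T (p ∸ 1)
CommonLeftExtension⇒lcp<GLPF-pred o T {p} {q} p∈ q∈ q≺p (c , cp , cq)
  with IsSuf-∷⇒preceded p p∈ cp | IsSuf-∷⇒preceded q q∈ cq
... | 1<p , p-1≡ | 1<q , q-1≡ = 1<p , (begin
  suc (lcp (suf T p) (suf T q))             ≡⟨ sym (lcp-∷ c (suf T p) (suf T q)) ⟩
  lcp (c ∷ suf T p) (c ∷ suf T q)           ≡⟨ cong₂ lcp (sym p-1≡) (sym q-1≡) ⟩
  lcp (suf T (p ∸ 1)) (suf T (q ∸ 1))       ≤⟨ GLPF-upper o T (p ∸ 1) (InRange-pred T 1<q q∈)
                                                 (subst₂ (λ Y Z → o ⊢ Y ≺ Z) (sym q-1≡) (sym p-1≡) (≺-∷⁺ o c q≺p)) ⟩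
  GLPF o T (p ∸ 1)                          ∎)
  where open ≤-Reasoning

shallow-edge⇒¬¬primary₋⊎drop : ∀ o T {p x X s} → InRange T p → STEdge T x X → suf T p ≡ (x ++ X) ++ s →
  length (x ++ X) ≤ GLPF o T p → ¬ ¬ (Primary₋ T (x , X) ⊎ GLPFDrop o T p)
shallow-edge⇒¬¬primary₋⊎drop o T {p} {x} {X} {s} p∈ edge S≡ shallow with GLPF-attained o T p
... | inj₁ ≡0 = contradiction (≤-trans shallow (≤-reflexive ≡0)) (<⇒≱ (STEdge-target-nonempty edge))
... | inj₂ (q , q∈ , q≺p , ≡lcp)
  with s′ , Sq≡ ← lcp-prefix (x ++ X) s (suf T q)
                    (subst (length (x ++ X) ≤_) (trans ≡lcp (cong (λ S → lcp S (suf T q)) S≡)) shallow) = λ k → ¬¬-excluded-middle {A = CommonLeftExtension T (suf T p) (suf T q)} λ where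
  (yes ext) → let 1<p , lcp< = CommonLeftExtension⇒lcp<GLPF-pred o T p∈ q∈ q≺p ext in
    k (inj₂ (1<p , subst (_< GLPF o T (p ∸ 1)) (sym ≡lcp) lcp<))
  (no ¬ext) → k (inj₁ (longest⇒primary₋ edge λ y _ → longest-in-class {T}
    (subst (IsSuf T) S≡ (suf-IsSuf p∈)) (subst (IsSuf T) Sq≡ (suf-IsSuf q∈))
    (λ ext → ¬ext (subst₂ (CommonLeftExtension T) (sym S≡) (sym Sq≡) ext)) y))

misplaced-edges⇒¬¬drop : ∀ o T {p} as₁ {x X} as₂ {y Y} bs → InRange T p →
  PathFrom T [] (suf T p) (as₁ ++ (x , X) ∷ as₂ ++ (y , Y) ∷ bs) →
  ¬ Primary₋ T (x , X) → ¬ Primary₊ o T (y , Y) → ¬ ¬ GLPFDrop o T p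
misplaced-edges⇒¬¬drop o T {p} as₁ {x} {X} as₂ bs p∈ path ¬g ¬f with path-++ as₁ path
... | _ , _ , S≡ , step g-edge path₂ with path-++ as₂ path₂
...   | m , _ , refl , step f-edge _ = λ k →
  shallow-edge⇒¬¬primary₋⊎drop o T p∈ g-edge S≡w++ shallow λ where
    (inj₁ primary) → ¬g primary
    (inj₂ drop) → k drop
  where
  S≡w++ : suf T p ≡ (x ++ X) ++ m ++ _
  S≡w++ = trans S≡ (sym (++-assoc x X _))
  shallow : length (x ++ X) ≤ GLPF o T p
  shallow = ≤-trans (length-++-≤ˡ (x ++ X)) (≮⇒≥ λ deep →
    ¬f (deep-edge⇒primary₊ o T p∈ f-edge (trans S≡w++ (sym (++-assoc (x ++ X) m _))) deep))

off-QI⇒¬¬drop : ∀ o T p → InRange T p → ¬ QI o T p → ¬ ¬ GLPFDrop o T p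
off-QI⇒¬¬drop o T p p∈ ¬qi ¬drop =
  ¬¬path (inj₁ refl) (inj₂ (inj₁ (suf-IsSuf p∈))) λ (es , path) →
  ¬¬-excluded-middle {A = All (Primary₊ o T) es} λ where
    (yes all₊) → ¬qi (p∈ , es , path , inj₁ all₊)
    (no ¬all₊) → ¬All⇒¬¬last-counterexample es ¬all₊ λ (as , f , bs , es≡ , ¬f , bs₊) →
      ¬¬-excluded-middle {A = All (Primary₋ T) as} λ where
        (yes as₋) → ¬qi (p∈ , es , path , inj₂ (as , f , bs , es≡ , as₋ , ¬f , bs₊))
        (no ¬as₋) → ¬All⇒¬¬last-counterexample as ¬as₋ λ (as₁ , g , as₂ , as≡ , ¬g , _) →
          misplaced-edges⇒¬¬drop o T as₁ as₂ bs p∈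
            (subst (PathFrom T [] (suf T p))
              (trans es≡ (trans (cong (_++ f ∷ bs) as≡) (++-assoc as₁ (g ∷ as₂) (f ∷ bs)))) path)
            ¬g ¬f ¬drop

GLPF-interpolation : ∀ o T p → InRange T p → ¬ QI o T p → 1 < p × GLPF o T p ≡ GLPF o T (p ∸ 1) ∸ 1
GLPF-interpolation o T p p∈ ¬qi =
  decidable-stable (1 <? p ×-dec GLPF o T p ≟ GLPF o T (p ∸ 1) ∸ 1)
                   (¬¬-map interpolate (off-QI⇒¬¬drop o T p p∈ ¬qi))
  where
  interpolate : GLPFDrop o T p → 1 < p × GLPF o T p ≡ GLPF o T (p ∸ 1) ∸ 1
  interpolate (1<p , drop) = 1<p , cong (_∸ 1) (≤-antisym drop (GLPF-pred≤suc o T 1<p (proj₂ p∈)))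

-- PLCP and LPF as GLPF arrays

IsPLCP⇒≡GLPF-lex : ∀ T p {a} → IsPLCP T p a → a ≡ GLPF lexo T p
IsPLCP⇒≡GLPF-lex T p (inj₁ (no-smaller , refl)) with GLPF-attained lexo T p
... | inj₁ ≡0 = sym ≡0
... | inj₂ (q , q∈ , q<p , _) = contradiction q<p (no-smaller q q∈)
IsPLCP⇒≡GLPF-lex T p (inj₂ (q , (q∈ , q<p , nothing-between) , refl)) =
  ≤-antisym (GLPF-upper lexo T p q∈ q<p) GLPF≤
  where
  GLPF≤ : GLPF lexo T p ≤ lcp (suf T p) (suf T q)
  GLPF≤ with GLPF-attained lexo T p
  ... | inj₁ ≡0 = ≤-trans (≤-reflexive ≡0) z≤n
  ... | inj₂ (r , r∈ , r<p , ≡lcp) rewrite ≡lcp with Lex.<-compare sym <-cmp (suf T q) (suf T r)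
  ...   | tri< q<r _ _ = contradiction (q<r , r<p) (nothing-between r r∈)
  ...   | tri≈ _ q≋r _ = ≤-reflexive (cong (lcp (suf T p)) (sym (Pointwise-≡⇒≡ q≋r)))
  ...   | tri> _ _ r<q = lcp-mono-<lex r<q q<p

LPF-upper : ∀ T p {q} → 1 ≤ q → q < p → lcp (suf T p) (suf T q) ≤ LPF T p
LPF-upper T (suc _) 1≤q (s≤s q≤p-1) = maxList-map-upper _ (∈-range1 1≤q q≤p-1)

LPF-attained : ∀ T p → LPF T p ≡ 0 ⊎ ∃ λ q → 1 ≤ q × q < p × LPF T p ≡ lcp (suf T p) (suf T q)
LPF-attained T zero = inj₁ refl
LPF-attained T (suc p) with maxList-map-attained (λ q → lcp (suf T (suc p)) (suf T q)) (range1 p)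
... | inj₁ ≡0 = inj₁ ≡0
... | inj₂ (q , q∈ , ≡lcp) = let 1≤q , q≤p = ∈-range1⁻ q∈ in inj₂ (q , 1≤q , s≤s q≤p , ≡lcp)

<⇒suf-≺pos : ∀ {T p q} → p ≤ length T → 1 ≤ q → q < p → posn ⊢ suf T q ≺ suf T p
<⇒suf-≺pos {T} {suc j} {suc i} p≤n _ (s≤s i<j) =
  subst₂ _<_ (sym (length-drop j T)) (sym (length-drop i T)) (∸-monoʳ-< i<j (<⇒≤ p≤n))

suf-≺pos⇒< : ∀ {T p q} → posn ⊢ suf T q ≺ suf T p → q < p
suf-≺pos⇒< {T} {p} {q} q≺p = ≰⇒> λ p≤q → <⇒≱ q≺p
  (subst₂ _≤_ (sym (length-drop (q ∸ 1) T)) (sym (length-drop (p ∸ 1) T))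
              (∸-monoʳ-≤ (length T) (∸-monoˡ-≤ 1 p≤q)))

LPF≡GLPF-pos : ∀ T p → InRange T p → LPF T p ≡ GLPF posn T p
LPF≡GLPF-pos T p p∈ = ≤-antisym LPF≤ GLPF≤
  where
  LPF≤ : LPF T p ≤ GLPF posn T p
  LPF≤ with LPF-attained T p
  ... | inj₁ ≡0 = ≤-trans (≤-reflexive ≡0) z≤n
  ... | inj₂ (q , 1≤q , q<p , ≡lcp) = subst (_≤ GLPF posn T p) (sym ≡lcp)
    (GLPF-upper posn T p (1≤q , ≤-trans (<⇒≤ q<p) (proj₂ p∈)) (<⇒suf-≺pos (proj₂ p∈) 1≤q q<p))
  GLPF≤ : GLPF posn T p ≤ LPF T p
  GLPF≤ with GLPF-attained posn T p
  ... | inj₁ ≡0 = ≤-trans (≤-reflexive ≡0) z≤n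
  ... | inj₂ (q , (1≤q , _) , q≺p , ≡lcp) =
    subst (_≤ LPF T p) (sym ≡lcp) (LPF-upper T p 1≤q (suf-≺pos⇒< q≺p))

proposition3 : (T : Str) → WellFormedText T →
    ((o : Ord₊) → (p : ℕ) → InRange T p → ¬ QI o T p →
        (1 < p) × (GLPF o T p ≡ GLPF o T (p ∸ 1) ∸ 1))
    × ((p : ℕ) → InRange T p → ¬ QI lexo T p →
        (1 < p) × (∀ a b → IsPLCP T p a → IsPLCP T (p ∸ 1) b → a ≡ b ∸ 1))
    × ((p : ℕ) → InRange T p → ¬ QI posn T p →
        (1 < p) × (LPF T p ≡ LPF T (p ∸ 1) ∸ 1))
proposition3 T _ = (λ o → GLPF-interpolation o T) , PLCP-interpolation , LPF-interpolation
  where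
  open ≡-Reasoning
  PLCP-interpolation : ∀ p → InRange T p → ¬ QI lexo T p →
                       1 < p × (∀ a b → IsPLCP T p a → IsPLCP T (p ∸ 1) b → a ≡ b ∸ 1)
  PLCP-interpolation p p∈ ¬qi with GLPF-interpolation lexo T p p∈ ¬qi
  ... | 1<p , GLPF≡ = 1<p , λ a b a-plcp b-plcp → begin
    a                         ≡⟨ IsPLCP⇒≡GLPF-lex T p a-plcp ⟩
    GLPF lexo T p             ≡⟨ GLPF≡ ⟩
    GLPF lexo T (p ∸ 1) ∸ 1   ≡⟨ cong (_∸ 1) (sym (IsPLCP⇒≡GLPF-lex T (p ∸ 1) b-plcp)) ⟩
    b ∸ 1                     ∎
  LPF-interpolation : ∀ p → InRange T p → ¬ QI posn T p → 1 < p × LPF T p ≡ LPF T (p ∸ 1) ∸ 1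
  LPF-interpolation p p∈ ¬qi with GLPF-interpolation posn T p p∈ ¬qi
  ... | 1<p , GLPF≡ = 1<p , (begin
    LPF T p                   ≡⟨ LPF≡GLPF-pos T p p∈ ⟩
    GLPF posn T p             ≡⟨ GLPF≡ ⟩
    GLPF posn T (p ∸ 1) ∸ 1   ≡⟨ cong (_∸ 1) (sym (LPF≡GLPF-pos T (p ∸ 1) (InRange-pred T 1<p p∈))) ⟩
    LPF T (p ∸ 1) ∸ 1         ∎)
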